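{- Let $\mathcal{M}=(V,\mathcal{I})$ be a matroid and let $\rho^*=\max_{U\subseteq V}\rho_{\mathcal{M}}(U)<+\infty$. If $W_1,W_2\subseteq V$ satisfy $\rho_{\mathcal{M}}(W_1)=\rho_{\mathcal{M}}(W_2)=\rho^*$, then $\rho_{\mathcal{M}}(W_1\cup W_2)=\rho^*$.
   Context: For $U\subseteq V$, $\rho_{\mathcal{M}}(U)=|U|/\mathrm{rank}_{\mathcal{M}}(U)$, with $\rho_{\mathcal{M}}(\emptyset)=0$ and $\rho_{\mathcal{M}}(U)=+\infty$ if $U\ne\emptyset$ has rank $0$. -}

module Defs where

open import Data.Nat using (ℕ; zero; suc; _<_; _⊔_)
open import Data.Integer using (+_)
open import Data.Rational using (ℚ; _/_) renaming (_≤_ to _≤ℚ_)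
open import Data.Bool using (Bool; true; false; if_then_else_)
open import Data.List using (List; []; _∷_; map; _++_; foldr)
open import Data.Vec using (_∷_; [])
open import Data.Fin using (Fin)
open import Data.Fin.Subset using (Subset; _⊆_; _∈_; _∉_; _∪_; ⁅_⁆; ∣_∣; ⊥; inside; outside)
open import Data.Fin.Subset.Properties using (_⊆?_)
open import Data.Product using (∃; _×_)
open import Relation.Binary.PropositionalEquality using (_≡_)
open import Relation.Nullary using (does)

record Matroid (n : ℕ) : Set where
  field
    indep      : Subset n → Bool
    indep-∅    : indep ⊥ ≡ true
    hereditary : ∀ {I J} → J ⊆ I → indep I ≡ true → indep J ≡ true
    exchange   : ∀ {I J} → indep I ≡ true → indep J ≡ true → ∣ I ∣ < ∣ J ∣ →
                 ∃ λ x → x ∈ J × x ∉ I × indep (I ∪ ⁅ x ⁆) ≡ true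
open Matroid public

allSubsets : (n : ℕ) → List (Subset n)
allSubsets zero = [] ∷ []
allSubsets (suc n) = map (outside ∷_) (allSubsets n) ++ map (inside ∷_) (allSubsets n)

rank : ∀ {n} → Matroid n → Subset n → ℕ
rank {n} M U = foldr (λ S r → (if does (S ⊆? U) then (if indep M S then ∣ S ∣ else 0) else 0) ⊔ r)
                     0 (allSubsets n)

data ℚ∞ : Set where
  fin : ℚ → ℚ∞
  ∞   : ℚ∞

data _≤∞_ : ℚ∞ → ℚ∞ → Set where
  fin≤fin : ∀ {p q} → p ≤ℚ q → fin p ≤∞ fin q
  _≤∞∞    : ∀ x → x ≤∞ ∞

density : ∀ {n} → Matroid n → Subset n → ℚ∞
density M U with rank M U | ∣ U ∣
... | zero  | zero  = fin (+ 0 / 1)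
... | zero  | suc _ = ∞
... | suc r | k     = fin (+ k / suc r)

-- Submodularity of the rank, r(W₁ ∪ W₂) + r(W₁ ∩ W₂) ≤ r(W₁) + r(W₂), together with
-- |W₁ ∪ W₂| + |W₁ ∩ W₂| = |W₁| + |W₂|, gives
--   |W₁ ∪ W₂| = |W₁| + |W₂| − |W₁ ∩ W₂| ≥ ρ* r(W₁) + ρ* r(W₂) − ρ* r(W₁ ∩ W₂) ≥ ρ* r(W₁ ∪ W₂),
-- using maximality of ρ* on W₁ ∩ W₂. So ρ(W₁ ∪ W₂) ≥ ρ*, and maximality gives equality.
-- Submodularity itself comes from extending a basis of W₁ ∩ W₂ to a basis of W₁ ∪ W₂.
module Submission where

open import Defs
open import Data.Nat using (ℕ)
open import Data.Fin.Subset using (Subset; _∪_)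
open import Data.Product using (∃; _×_)
open import Relation.Binary.PropositionalEquality using (_≡_; _≢_)

open import Data.Nat using (zero; suc; _+_; _*_; _≤_; _<_; _⊔_; _∸_; z≤n; s≤s)
open import Data.Nat.Properties
open import Data.Integer using (+_)
import Data.Integer as ℤ
import Data.Integer.Properties as ℤ
open import Data.Rational using (_/_) renaming (_≤_ to _≤ℚ_)
open import Data.Rational.Properties using (toℚᵘ-mono-≤; toℚᵘ-fromℚᵘ; fromℚᵘ-cong)
open import Data.Rational.Unnormalised using (mkℚᵘ; *≤*; *≡*)
open import Data.Rational.Unnormalised.Properties using (≤-respˡ-≃; ≤-respʳ-≃)
open import Data.Bool using (true; false; if_then_else_)
open import Data.List using (List; []; _∷_; map; foldr)
open import Data.List.Membership.Propositional using () renaming (_∈_ to _∈ₗ_)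
open import Data.List.Membership.Propositional.Properties using (∈-map⁺; ∈-++⁺ˡ; ∈-++⁺ʳ)
open import Data.List.Relation.Unary.Any using (here; there)
open import Data.Vec using (_∷_; [])
open import Data.Vec.Base using () renaming (here to hereᵥ; there to thereᵥ)
open import Data.Fin using (Fin)
import Data.Fin as Fin
open import Data.Fin.Subset using (_⊆_; _∉_; _∩_; ⁅_⁆; ∣_∣; ⊥; inside; outside)
open import Data.Fin.Subset.Properties
open import Data.Product using (_,_)
open import Data.Sum using (inj₁; inj₂)
open import Data.Empty using (⊥-elim)
open import Function using (_∘_)
open import Relation.Nullary using (does; yes; no)
open import Relation.Binary.PropositionalEquality using (refl; sym; trans; cong; cong₂; subst; subst₂; module ≡-Reasoning)

private
  variable
    n : ℕ

∣p∪q∣+∣p∩q∣≡∣p∣+∣q∣ : (p q : Subset n) → ∣ p ∪ q ∣ + ∣ p ∩ q ∣ ≡ ∣ p ∣ + ∣ q ∣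
∣p∪q∣+∣p∩q∣≡∣p∣+∣q∣ []            []            = refl
∣p∪q∣+∣p∩q∣≡∣p∣+∣q∣ (inside ∷ p)  (inside ∷ q)  =
  cong suc (trans (+-suc _ _) (trans (cong suc (∣p∪q∣+∣p∩q∣≡∣p∣+∣q∣ p q)) (sym (+-suc _ _))))
∣p∪q∣+∣p∩q∣≡∣p∣+∣q∣ (inside ∷ p)  (outside ∷ q) = cong suc (∣p∪q∣+∣p∩q∣≡∣p∣+∣q∣ p q)
∣p∪q∣+∣p∩q∣≡∣p∣+∣q∣ (outside ∷ p) (inside ∷ q)  =
  trans (cong suc (∣p∪q∣+∣p∩q∣≡∣p∣+∣q∣ p q)) (sym (+-suc _ _))
∣p∪q∣+∣p∩q∣≡∣p∣+∣q∣ (outside ∷ p) (outside ∷ q) = ∣p∪q∣+∣p∩q∣≡∣p∣+∣q∣ p q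

x∉p⇒∣p∪⁅x⁆∣≡1+∣p∣ : (p : Subset n) (x : Fin n) → x ∉ p → ∣ p ∪ ⁅ x ⁆ ∣ ≡ suc ∣ p ∣
x∉p⇒∣p∪⁅x⁆∣≡1+∣p∣ (inside ∷ p)  Fin.zero    x∉p = ⊥-elim (x∉p hereᵥ)
x∉p⇒∣p∪⁅x⁆∣≡1+∣p∣ (outside ∷ p) Fin.zero    x∉p = cong (λ q → suc ∣ q ∣) (∪-identityʳ p)
x∉p⇒∣p∪⁅x⁆∣≡1+∣p∣ (inside ∷ p)  (Fin.suc x) x∉p = cong suc (x∉p⇒∣p∪⁅x⁆∣≡1+∣p∣ p x (x∉p ∘ thereᵥ))
x∉p⇒∣p∪⁅x⁆∣≡1+∣p∣ (outside ∷ p) (Fin.suc x) x∉p = x∉p⇒∣p∪⁅x⁆∣≡1+∣p∣ p x (x∉p ∘ thereᵥ)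

∈-allSubsets : (p : Subset n) → p ∈ₗ allSubsets n
∈-allSubsets []            = here refl
∈-allSubsets (outside ∷ p) = ∈-++⁺ˡ (∈-map⁺ (outside ∷_) (∈-allSubsets p))
∈-allSubsets {suc n} (inside ∷ p) =
  ∈-++⁺ʳ (map (outside ∷_) (allSubsets n)) (∈-map⁺ (inside ∷_) (∈-allSubsets p))

IsBasis : Matroid n → Subset n → Subset n → Set
IsBasis M U B = B ⊆ U × indep M B ≡ true × ∣ B ∣ ≡ rank M U

module _ (M : Matroid n) (U : Subset n) where

  -- rank M U is rankOver (allSubsets n) by definition.
  rankOver : List (Subset n) → ℕ
  rankOver = foldr (λ S r → (if does (S ⊆? U) then (if indep M S then ∣ S ∣ else 0) else 0) ⊔ r) 0

  ∣I∣≤rankOver : ∀ {L I} → I ∈ₗ L → I ⊆ U → indep M I ≡ true → ∣ I ∣ ≤ rankOver L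
  ∣I∣≤rankOver {I = I} (here refl) I⊆U indI with I ⊆? U
  ... | no I⊈U = ⊥-elim (I⊈U I⊆U)
  ... | yes _ rewrite indI = m≤m⊔n _ _
  ∣I∣≤rankOver (there I∈L) I⊆U indI = ≤-trans (∣I∣≤rankOver I∈L I⊆U indI) (m≤n⊔m _ _)

  rankOver-attained : ∀ L → ∃ λ I → I ⊆ U × indep M I ≡ true × ∣ I ∣ ≡ rankOver L
  rankOver-attained [] = ⊥ , ⊥⊆ , indep-∅ M , ∣⊥∣≡0 n
  rankOver-attained (S ∷ L) with S ⊆? U | indep M S in indS
  ... | no _    | _     = rankOver-attained L
  ... | yes _   | false = rankOver-attained L
  ... | yes S⊆U | true with ≤-total ∣ S ∣ (rankOver L)
  ...   | inj₂ S≥ = S , S⊆U , indS , sym (m≥n⇒m⊔n≡m S≥)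
  ...   | inj₁ S≤ with rankOver-attained L
  ...     | I , I⊆U , indI , ∣I∣≡ = I , I⊆U , indI , trans ∣I∣≡ (sym (m≤n⇒m⊔n≡n S≤))

  independent⇒∣I∣≤rank : ∀ {I} → I ⊆ U → indep M I ≡ true → ∣ I ∣ ≤ rank M U
  independent⇒∣I∣≤rank {I} = ∣I∣≤rankOver (∈-allSubsets I)

  basis-exists : ∃ (IsBasis M U)
  basis-exists = rankOver-attained (allSubsets n)

  augment : ∀ {I} → I ⊆ U → indep M I ≡ true → ∣ I ∣ < rank M U →
            ∃ λ x → x ∉ I × I ∪ ⁅ x ⁆ ⊆ U × indep M (I ∪ ⁅ x ⁆) ≡ true
  augment {I} I⊆U indI ∣I∣<r with basis-exists
  ... | B , B⊆U , indB , ∣B∣≡r with exchange M indI indB (subst (∣ I ∣ <_) (sym ∣B∣≡r) ∣I∣<r)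
  ... | x , x∈B , x∉I , indIx = x , x∉I , Ix⊆U , indIx
    where
    Ix⊆U : I ∪ ⁅ x ⁆ ⊆ U
    Ix⊆U y∈Ix with x∈p∪q⁻ I ⁅ x ⁆ y∈Ix
    ... | inj₁ y∈I = I⊆U y∈I
    ... | inj₂ y∈⁅x⁆ rewrite x∈⁅y⁆⇒x≡y x y∈⁅x⁆ = B⊆U x∈B

  extend-to-basis : ∀ {I} → I ⊆ U → indep M I ≡ true → ∃ λ B → I ⊆ B × IsBasis M U B
  extend-to-basis {I} I⊆U indI = go (rank M U ∸ ∣ I ∣) I⊆U indI (m∸n+n≡m (independent⇒∣I∣≤rank I⊆U indI))
    where
    go : ∀ d {I} → I ⊆ U → indep M I ≡ true → d + ∣ I ∣ ≡ rank M U → ∃ λ B → I ⊆ B × IsBasis M U B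
    go zero    I⊆U indI ∣I∣≡r = _ , (λ i → i) , I⊆U , indI , ∣I∣≡r
    go (suc d) {I} I⊆U indI d+∣I∣≡r
      with augment I⊆U indI (subst (∣ I ∣ <_) d+∣I∣≡r (s≤s (m≤n+m ∣ I ∣ d)))
    ... | x , x∉I , Ix⊆U , indIx
      with go d Ix⊆U indIx (trans (cong (λ k → d + k) (x∉p⇒∣p∪⁅x⁆∣≡1+∣p∣ I x x∉I)) (trans (+-suc d _) d+∣I∣≡r))
    ... | B , Ix⊆B , isBasis = B , Ix⊆B ∘ p⊆p∪q ⁅ x ⁆ , isBasis

rank-mono : (M : Matroid n) {U V : Subset n} → U ⊆ V → rank M U ≤ rank M V
rank-mono M {U} {V} U⊆V with basis-exists M U
... | B , B⊆U , indB , ∣B∣≡r = subst (_≤ rank M V) ∣B∣≡r (independent⇒∣I∣≤rank M V (U⊆V ∘ B⊆U) indB)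

-- A basis B of U ∩ V extends to a basis J of U ∪ V; then B ⊆ (J ∩ U) ∩ (J ∩ V) and
-- J ⊆ (J ∩ U) ∪ (J ∩ V), where J ∩ U and J ∩ V are independent in U and V.
rank-submodular : (M : Matroid n) (U V : Subset n) →
                  rank M (U ∪ V) + rank M (U ∩ V) ≤ rank M U + rank M V
rank-submodular M U V with basis-exists M (U ∩ V)
... | B , B⊆U∩V , indB , ∣B∣≡r∩
  with extend-to-basis M (U ∪ V) (λ x∈B → p⊆p∪q V (p∩q⊆p U V (B⊆U∩V x∈B))) indB
... | J , B⊆J , J⊆U∪V , indJ , ∣J∣≡r∪ = begin
    rank M (U ∪ V) + rank M (U ∩ V) ≡⟨ cong₂ _+_ (sym ∣J∣≡r∪) (sym ∣B∣≡r∩) ⟩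
    ∣ J ∣ + ∣ B ∣                   ≤⟨ +-mono-≤ (p⊆q⇒∣p∣≤∣q∣ J⊆JU∪JV) (p⊆q⇒∣p∣≤∣q∣ B⊆JU∩JV) ⟩
    ∣ JU ∪ JV ∣ + ∣ JU ∩ JV ∣       ≡⟨ ∣p∪q∣+∣p∩q∣≡∣p∣+∣q∣ JU JV ⟩
    ∣ JU ∣ + ∣ JV ∣                 ≤⟨ +-mono-≤ (restriction-bound U) (restriction-bound V) ⟩
    rank M U + rank M V             ∎
  where
  open ≤-Reasoning
  JU = J ∩ U
  JV = J ∩ V
  restriction-bound : ∀ W → ∣ J ∩ W ∣ ≤ rank M W
  restriction-bound W = independent⇒∣I∣≤rank M W (p∩q⊆q J W) (hereditary M (p∩q⊆p J W) indJ)
  J⊆JU∪JV : J ⊆ JU ∪ JV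
  J⊆JU∪JV x∈J with x∈p∪q⁻ U V (J⊆U∪V x∈J)
  ... | inj₁ x∈U = x∈p∪q⁺ (inj₁ (x∈p∩q⁺ (x∈J , x∈U)))
  ... | inj₂ x∈V = x∈p∪q⁺ (inj₂ (x∈p∩q⁺ (x∈J , x∈V)))
  B⊆JU∩JV : B ⊆ JU ∩ JV
  B⊆JU∩JV x∈B with x∈p∩q⁻ U V (B⊆U∩V x∈B)
  ... | x∈U , x∈V = x∈p∩q⁺ (x∈p∩q⁺ (B⊆J x∈B , x∈U) , x∈p∩q⁺ (B⊆J x∈B , x∈V))

/-≤⇒*-≤ : ∀ a b c d → + a / suc c ≤ℚ + b / suc d → a * suc d ≤ b * suc c
/-≤⇒*-≤ a b c d a/c≤b/d
  with ≤-respʳ-≃ (toℚᵘ-fromℚᵘ (mkℚᵘ (+ b) d)) (≤-respˡ-≃ (toℚᵘ-fromℚᵘ (mkℚᵘ (+ a) c)) (toℚᵘ-mono-≤ a/c≤b/d))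
... | *≤* ad≤bc = ℤ.drop‿+≤+ (subst₂ ℤ._≤_ (sym (ℤ.pos-* a (suc d))) (sym (ℤ.pos-* b (suc c))) ad≤bc)

*-≡⇒/-≡ : ∀ a b c d → a * suc d ≡ b * suc c → + a / suc c ≡ + b / suc d
*-≡⇒/-≡ a b c d ad≡bc = fromℚᵘ-cong {mkℚᵘ (+ a) c} {mkℚᵘ (+ b) d}
  (*≡* (trans (sym (ℤ.pos-* a (suc d))) (trans (cong +_ ad≡bc) (ℤ.pos-* b (suc c)))))

infix 21 _÷_
_÷_ : ℕ → ℕ → ℚ∞
k     ÷ suc r = fin (+ k / suc r)
zero  ÷ zero  = fin (+ 0 / 1)
suc _ ÷ zero  = ∞

density≡∣U∣÷rank : (M : Matroid n) (U : Subset n) → density M U ≡ ∣ U ∣ ÷ rank M U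
density≡∣U∣÷rank M U with rank M U | ∣ U ∣
... | zero  | zero  = refl
... | zero  | suc _ = refl
... | suc _ | _     = refl

÷-≤⇒*-≤ : ∀ k r k′ r′ → k ÷ r ≤∞ k′ ÷ r′ → k′ ÷ r′ ≢ ∞ → k * r′ ≤ k′ * r
÷-≤⇒*-≤ _       _       (suc _) zero    _ ≢∞ = ⊥-elim (≢∞ refl)
÷-≤⇒*-≤ k       _       zero    zero    _ _ rewrite *-zeroʳ k = z≤n
÷-≤⇒*-≤ zero    zero    _       (suc _) _ _ = z≤n
÷-≤⇒*-≤ (suc _) zero    _       (suc _) () _
÷-≤⇒*-≤ k       (suc r) k′      (suc r′) (fin≤fin k/r≤k′/r′) _ = /-≤⇒*-≤ k k′ r r′ k/r≤k′/r′

-- The hypothesis r′ ≤ r excludes r = 0 < r′, where the cross-multiplied inequality says nothing.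
÷-≡ : ∀ k r k′ r′ → k ÷ r ≤∞ k′ ÷ r′ → k′ ÷ r′ ≢ ∞ → r′ ≤ r → k′ * r ≤ k * r′ → k ÷ r ≡ k′ ÷ r′
÷-≡ _       _       (suc _) zero     _ ≢∞ _ _ = ⊥-elim (≢∞ refl)
÷-≡ zero    zero    zero    zero     _ _ _ _ = refl
÷-≡ (suc _) zero    zero    zero     () _ _ _
÷-≡ k       (suc r) zero    zero     (fin≤fin k/r≤0) _ _ _
  rewrite n≤0⇒n≡0 (subst (_≤ 0) (*-identityʳ k) (/-≤⇒*-≤ k 0 r 0 k/r≤0)) = cong fin (*-≡⇒/-≡ 0 0 r 0 refl)
÷-≡ _       zero    _       (suc _)  _ _ () _
÷-≡ k       (suc r) k′      (suc r′) (fin≤fin k/r≤k′/r′) _ _ k′r≤kr′ =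
  cong fin (*-≡⇒/-≡ k k′ r r′ (≤-antisym (/-≤⇒*-≤ k k′ r r′ k/r≤k′/r′) k′r≤kr′))

-- Cross-multiplied form of ρ(W₁ ∪ W₂) ≥ ρ(W₁) when ρ(W₁) ≤ ρ(W₂), ρ(W₁ ∩ W₂) ≤ ρ(W₁),
-- ranks are submodular and cardinalities modular.
union-density-≥ : ∀ k₁ k₂ k∪ k∩ r₁ r₂ r∪ r∩ →
  k₁ * r₂ ≤ k₂ * r₁ → k∩ * r₁ ≤ k₁ * r∩ → r∪ + r∩ ≤ r₁ + r₂ → k∪ + k∩ ≡ k₁ + k₂ →
  k₁ * r∪ ≤ k∪ * r₁
union-density-≥ k₁ k₂ k∪ k∩ r₁ r₂ r∪ r∩ ρ₁≤ρ₂ ρ∩≤ρ₁ submodular modular =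
  +-cancelʳ-≤ (k₁ * r∩) (k₁ * r∪) (k∪ * r₁) (begin
    k₁ * r∪ + k₁ * r∩   ≡⟨ *-distribˡ-+ k₁ r∪ r∩ ⟨
    k₁ * (r∪ + r∩)      ≤⟨ *-monoʳ-≤ k₁ submodular ⟩
    k₁ * (r₁ + r₂)      ≡⟨ *-distribˡ-+ k₁ r₁ r₂ ⟩
    k₁ * r₁ + k₁ * r₂   ≤⟨ +-monoʳ-≤ (k₁ * r₁) ρ₁≤ρ₂ ⟩
    k₁ * r₁ + k₂ * r₁   ≡⟨ *-distribʳ-+ r₁ k₁ k₂ ⟨
    (k₁ + k₂) * r₁      ≡⟨ cong (_* r₁) modular ⟨
    (k∪ + k∩) * r₁      ≡⟨ *-distribʳ-+ r₁ k∪ k∩ ⟩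
    k∪ * r₁ + k∩ * r₁   ≤⟨ +-monoʳ-≤ (k∪ * r₁) ρ∩≤ρ₁ ⟩
    k∪ * r₁ + k₁ * r∩   ∎)
  where open ≤-Reasoning

proposition16 : ∀ {n : ℕ} (M : Matroid n) (ρ* : ℚ∞) →
    (∃ λ U → density M U ≡ ρ*) → (∀ U → density M U ≤∞ ρ*) → ρ* ≢ ∞ →
    (W₁ W₂ : Subset n) → density M W₁ ≡ ρ* → density M W₂ ≡ ρ* →
    density M (W₁ ∪ W₂) ≡ ρ*
proposition16 M _ _ maximal ρ*≢∞ W₁ W₂ refl ρ₂≡ρ₁ = begin
  density M (W₁ ∪ W₂) ≡⟨ density≡∣U∣÷rank M (W₁ ∪ W₂) ⟩
  k∪ ÷ r∪             ≡⟨ ÷-≡ k∪ r∪ k₁ r₁ (maximal′ (W₁ ∪ W₂)) ρ₁≢∞ (rank-mono M (p⊆p∪q W₂)) ρ∪≥ρ₁ ⟩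
  k₁ ÷ r₁             ≡⟨ density≡∣U∣÷rank M W₁ ⟨
  density M W₁        ∎
  where
  open ≡-Reasoning
  k₁ = ∣ W₁ ∣ ; k₂ = ∣ W₂ ∣ ; k∪ = ∣ W₁ ∪ W₂ ∣ ; k∩ = ∣ W₁ ∩ W₂ ∣
  r₁ = rank M W₁ ; r₂ = rank M W₂ ; r∪ = rank M (W₁ ∪ W₂) ; r∩ = rank M (W₁ ∩ W₂)
  ρ₁≢∞ : k₁ ÷ r₁ ≢ ∞
  ρ₁≢∞ = ρ*≢∞ ∘ trans (density≡∣U∣÷rank M W₁)
  maximal′ : ∀ U → ∣ U ∣ ÷ rank M U ≤∞ k₁ ÷ r₁
  maximal′ U = subst₂ _≤∞_ (density≡∣U∣÷rank M U) (density≡∣U∣÷rank M W₁) (maximal U)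
  ρ₂≡ρ₁′ : k₂ ÷ r₂ ≡ k₁ ÷ r₁
  ρ₂≡ρ₁′ = trans (sym (density≡∣U∣÷rank M W₂)) (trans ρ₂≡ρ₁ (density≡∣U∣÷rank M W₁))
  ρ∪≥ρ₁ : k₁ * r∪ ≤ k∪ * r₁
  ρ∪≥ρ₁ = union-density-≥ k₁ k₂ k∪ k∩ r₁ r₂ r∪ r∩
    (÷-≤⇒*-≤ k₁ r₁ k₂ r₂ (subst (k₁ ÷ r₁ ≤∞_) (sym ρ₂≡ρ₁′) (maximal′ W₁)) (ρ₁≢∞ ∘ trans (sym ρ₂≡ρ₁′)))
    (÷-≤⇒*-≤ k∩ r∩ k₁ r₁ (maximal′ (W₁ ∩ W₂)) ρ₁≢∞)
    (rank-submodular M W₁ W₂)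
    (∣p∪q∣+∣p∩q∣≡∣p∣+∣q∣ W₁ W₂)
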